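{- Let $P_n$ denote the path on $n$ vertices with every vertex having initial weight $1$. Then for all positive integers $n,m$, $a_t(P_{n+m}) \le a_t(P_n) + a_t(P_m)$; i.e., the sequence $(a_t(P_n))_{n\ge1}$ is subadditive.
   Context: Let $G$ be a graph whose vertices carry nonnegative integer weights $w(v)$. An acquisition move consists of choosing adjacent vertices $u,v$ with current weights satisfying $w(u)\ge w(v)>0$ and transferring all of the weight of $v$ to $u$. A sequence of acquisition moves after which no further move is possible is an acquisition protocol; the set of vertices with nonzero weight at its end is the residual set. The total acquisition number $a_t(G)$ is the minimum size of a residual set over all acquisition protocols. -}

module Defs where

open import Data.Nat using (ℕ; zero; suc; _+_; _≤_; _<_)
open import Data.Fin using (Fin; toℕ)
open import Data.List using (List; length; filter)
open import Data.List using () renaming (allFin to allFinL)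
open import Data.Product using (Σ; ∃; _×_; _,_)
open import Data.Sum using (_⊎_)
open import Relation.Nullary using (¬_; ¬?)
open import Relation.Binary.PropositionalEquality using (_≡_)
open import Relation.Binary.Construct.Closure.ReflexiveTransitive using (Star)
open import Data.Nat.Properties using (_≟_)

-- A graph on vertex set Fin n, given by its (symmetric, loopless) adjacency relation.
Graph : ℕ → Set₁
Graph n = Fin n → Fin n → Set

Weight : ℕ → Set
Weight n = Fin n → ℕ

record Move {n : ℕ} (G : Graph n) (w w' : Weight n) : Set where
  field
    u v      : Fin n
    adj      : G u v
    v≤u      : w v ≤ w u
    v>0      : 0 < w v
    at-u     : w' u ≡ w u + w v
    at-v     : w' v ≡ 0
    elsewhere : ∀ x → ¬ (x ≡ u) → ¬ (x ≡ v) → w' x ≡ w x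

Terminal : {n : ℕ} → Graph n → Weight n → Set
Terminal G w = ∀ u v → G u v → w v ≤ w u → w v ≡ 0

residualSize : {n : ℕ} → Weight n → ℕ
residualSize {n} w = length (filter (λ x → ¬? (w x ≟ 0)) (allFinL n))

Protocol : {n : ℕ} → Graph n → Weight n → Weight n → Set
Protocol G w w' = Star (Move G) w w' × Terminal G w'

IsTotalAcqNumber : {n : ℕ} → Graph n → Weight n → ℕ → Set
IsTotalAcqNumber G w k =
  (∃ λ w' → Protocol G w w' × residualSize w' ≡ k) ×
  (∀ w' → Protocol G w w' → k ≤ residualSize w')

PathG : (n : ℕ) → Graph n
PathG n i j = (suc (toℕ i) ≡ toℕ j) ⊎ (suc (toℕ j) ≡ toℕ i)

ones : (n : ℕ) → Weight n
ones n _ = 1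

atPath : ℕ → ℕ → Set
atPath n k = IsTotalAcqNumber (PathG n) (ones n) k

module Submission where

-- Run a protocol of residual size a on the first n vertices of P_(n+m) and one of
-- residual size b on the last m: the two halves never interact, and finishing the
-- combined play arbitrarily can only shrink the residual set, so some protocol of
-- P_(n+m) ends with at most a + b nonzero vertices.  The constructive content is that
-- a_t exists at all: whether some protocol ends with residual size ≤ k is decidable,
-- by recursion on the size of the support, which every move strictly decreases.

open import Defs
open import Data.Nat using (ℕ; zero; suc; _+_; _≤_; _<_; _≤?_; _<?_; z≤n; s≤s)
open import Data.Nat.Properties
  using (_≟_; ≤-refl; ≤-trans; ≤-antisym; <⇒≤; <-≤-trans; ≮⇒≥; +-mono-≤; +-mono-<-≤; +-mono-≤-<;
         +-assoc; +-suc; 1+n≢n; n≢0⇒n>0; n<1+n; m<1+n⇒m<n∨m≡n)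
open import Data.Nat.Induction using (<-wellFounded)
open import Data.Fin using (Fin; zero; suc; toℕ; splitAt; _↑ˡ_; _↑ʳ_) renaming (_≟_ to _≟ᶠ_)
open import Data.Fin.Properties using (any?; all?; toℕ-↑ˡ; toℕ-↑ʳ; splitAt⁻¹-↑ˡ; splitAt⁻¹-↑ʳ)
open import Data.Vec.Functional using (_++_)
open import Data.Vec.Functional.Properties using (lookup-++ˡ; lookup-++ʳ)
open import Data.List using (length; filter; tabulate)
open import Data.Product using (∃; ∃₂; _×_; _,_; proj₁; proj₂)
open import Data.Sum using (_⊎_; inj₁; inj₂; [_,_]′)
import Data.Sum as Sum
open import Function using (id; _∘_)
open import Induction.WellFounded using (Acc; acc)
open import Relation.Unary using (Decidable)
open import Relation.Nullary using (¬_; ¬?; Dec; yes; no; contradiction)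
open import Relation.Nullary.Decidable using (map′; _×-dec_; _⊎-dec_; _→-dec_)
open import Relation.Binary.PropositionalEquality
  using (_≡_; _≢_; _≗_; refl; sym; trans; cong; cong₂; subst; subst₂; module ≡-Reasoning)
open import Relation.Binary.Construct.Closure.ReflexiveTransitive using (Star; ε; _◅_; _◅◅_; gmap)

sign : ℕ → ℕ
sign zero    = 0
sign (suc _) = 1

countNonzero : ∀ n → Weight n → ℕ
countNonzero zero    w = 0
countNonzero (suc n) w = sign (w zero) + countNonzero n (w ∘ suc)

residualSize-tabulate : ∀ {N} (w : Weight N) n (f : Fin n → Fin N) →
  length (filter (λ x → ¬? (w x ≟ 0)) (tabulate f)) ≡ countNonzero n (w ∘ f)
residualSize-tabulate w zero    f = refl
residualSize-tabulate w (suc n) f with w (f zero)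
... | zero  = residualSize-tabulate w n (f ∘ suc)
... | suc _ = cong suc (residualSize-tabulate w n (f ∘ suc))

residualSize≡countNonzero : ∀ {n} (w : Weight n) → residualSize w ≡ countNonzero n w
residualSize≡countNonzero {n} w = residualSize-tabulate w n id

countNonzero-cong : ∀ n {w w′ : Weight n} → w ≗ w′ → countNonzero n w ≡ countNonzero n w′
countNonzero-cong zero    w≗w′ = refl
countNonzero-cong (suc n) w≗w′ = cong₂ _+_ (cong sign (w≗w′ zero)) (countNonzero-cong n (w≗w′ ∘ suc))

residualSize-cong : ∀ {n} {w w′ : Weight n} → w ≗ w′ → residualSize w ≡ residualSize w′
residualSize-cong {n} {w} {w′} w≗w′ = begin
  residualSize w    ≡⟨ residualSize≡countNonzero w ⟩
  countNonzero n w  ≡⟨ countNonzero-cong n w≗w′ ⟩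
  countNonzero n w′ ≡⟨ residualSize≡countNonzero w′ ⟨
  residualSize w′   ∎
  where open ≡-Reasoning

sign-mono : ∀ {a b} → (0 < a → 0 < b) → sign a ≤ sign b
sign-mono {zero}          _   = z≤n
sign-mono {suc a} {zero}  a⇒b = contradiction (a⇒b (s≤s z≤n)) λ ()
sign-mono {suc a} {suc b} _   = ≤-refl

sign-< : ∀ {a b} → a ≡ 0 → 0 < b → sign a < sign b
sign-< {b = suc b} refl _ = s≤s z≤n

countNonzero-mono : ∀ n {w w′ : Weight n} → (∀ x → 0 < w′ x → 0 < w x) →
  countNonzero n w′ ≤ countNonzero n w
countNonzero-mono zero    _    = z≤n
countNonzero-mono (suc n) supp = +-mono-≤ (sign-mono (supp zero)) (countNonzero-mono n (supp ∘ suc))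

countNonzero-< : ∀ n {w w′ : Weight n} → (∀ x → 0 < w′ x → 0 < w x) →
  ∀ v → w′ v ≡ 0 → 0 < w v → countNonzero n w′ < countNonzero n w
countNonzero-< (suc n) supp zero    w′v≡0 w>0 =
  +-mono-<-≤ (sign-< w′v≡0 w>0) (countNonzero-mono n (supp ∘ suc))
countNonzero-< (suc n) supp (suc v) w′v≡0 w>0 =
  +-mono-≤-< (sign-mono (supp zero)) (countNonzero-< n (supp ∘ suc) v w′v≡0 w>0)

Move⇒residualSize-< : ∀ {n} {G : Graph n} {w w′ : Weight n} →
  Move G w w′ → residualSize w′ < residualSize w
Move⇒residualSize-< {n} {w = w} {w′} m
  rewrite residualSize≡countNonzero w | residualSize≡countNonzero w′ =
  countNonzero-< n support-shrinks v at-v v>0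
  where
  open Move m
  support-shrinks : ∀ x → 0 < w′ x → 0 < w x
  support-shrinks x w′x>0 with x ≟ᶠ u | x ≟ᶠ v
  ... | yes refl | _        = <-≤-trans v>0 v≤u
  ... | no _     | yes refl = contradiction (subst (0 <_) at-v w′x>0) λ ()
  ... | no x≢u   | no x≢v   = subst (0 <_) (elsewhere x x≢u x≢v) w′x>0

module _ {n N} {G : Graph n} {H : Graph N} (ι : Fin n → Fin N)
         (ι-hom : ∀ {u v} → G u v → H (ι u) (ι v)) where

  Move-embed : ∀ {w w′ : Weight n} {W W′ : Weight N} → W ∘ ι ≗ w → W′ ∘ ι ≗ w′ →
    (∀ x → (∃ λ i → x ≡ ι i) ⊎ W′ x ≡ W x) → Move G w w′ → Move H W W′
  Move-embed {w} {w′} {W} {W′} W≗w W′≗w′ frame m = record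
    { u         = ι u
    ; v         = ι v
    ; adj       = ι-hom adj
    ; v≤u       = subst₂ _≤_ (sym (W≗w v)) (sym (W≗w u)) v≤u
    ; v>0       = subst (0 <_) (sym (W≗w v)) v>0
    ; at-u      = trans (W′≗w′ u) (trans at-u (sym (cong₂ _+_ (W≗w u) (W≗w v))))
    ; at-v      = trans (W′≗w′ v) at-v
    ; elsewhere = elsewhere′
    }
    where
    open Move m
    elsewhere′ : ∀ x → x ≢ ι u → x ≢ ι v → W′ x ≡ W x
    elsewhere′ x x≢ιu x≢ιv with frame x
    ... | inj₂ W′x≡Wx    = W′x≡Wx
    ... | inj₁ (i , refl) = begin
      W′ (ι i) ≡⟨ W′≗w′ i ⟩
      w′ i     ≡⟨ elsewhere i (x≢ιu ∘ cong ι) (x≢ιv ∘ cong ι) ⟩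
      w i      ≡⟨ W≗w i ⟨
      W (ι i)  ∎
      where open ≡-Reasoning

Move-cong : ∀ {n} {G : Graph n} {w₁ w₁′ w₂ w₂′ : Weight n} →
  w₂ ≗ w₁ → w₂′ ≗ w₁′ → Move G w₁ w₁′ → Move G w₂ w₂′
Move-cong w₂≗w₁ w₂′≗w₁′ = Move-embed id id w₂≗w₁ w₂′≗w₁′ (λ x → inj₁ (x , refl))

Terminal-cong : ∀ {n} {G : Graph n} {w₁ w₂ : Weight n} → w₂ ≗ w₁ → Terminal G w₁ → Terminal G w₂
Terminal-cong w₂≗w₁ t u v adj v≤u =
  trans (w₂≗w₁ v) (t u v adj (subst₂ _≤_ (w₂≗w₁ v) (w₂≗w₁ u) v≤u))

Reach : ∀ {n} → Graph n → Weight n → ℕ → Set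
Reach G w k = ∃ λ w′ → Protocol G w w′ × residualSize w′ ≤ k

module _ {n} {G : Graph n} where

  Reach-cong : ∀ {w₁ w₂ k} → w₂ ≗ w₁ → Reach G w₁ k → Reach G w₂ k
  Reach-cong w₂≗w₁ (_ , (ε , t) , ≤k) =
    _ , (ε , Terminal-cong w₂≗w₁ t) , subst (_≤ _) (residualSize-cong (sym ∘ w₂≗w₁)) ≤k
  Reach-cong w₂≗w₁ (w′ , (m ◅ ms , t) , ≤k) =
    w′ , (Move-cong w₂≗w₁ (λ _ → refl) m ◅ ms , t) , ≤k

  Reach-mono : ∀ {w k k′} → k ≤ k′ → Reach G w k → Reach G w k′
  Reach-mono k≤k′ (w′ , p , ≤k) = w′ , p , ≤-trans ≤k k≤k′

  Reach-◅◅ : ∀ {w w₁ k} → Star (Move G) w w₁ → Reach G w₁ k → Reach G w k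
  Reach-◅◅ ms (w′ , (ms′ , t) , ≤k) = w′ , (ms ◅◅ ms′ , t) , ≤k

  IsTotalAcqNumber⇒≤ : ∀ {w c k} → IsTotalAcqNumber G w c → Reach G w k → c ≤ k
  IsTotalAcqNumber⇒≤ (_ , minimal) (w′ , p , ≤k) = ≤-trans (minimal w′ p) ≤k

module _ {p} {P : ℕ → Set p} (P? : Decidable P) where

  least-below : ∀ K → (∃ λ k → P k × ∀ {j} → P j → k ≤ j) ⊎ (∀ {j} → j < K → ¬ P j)
  least-below zero = inj₂ λ ()
  least-below (suc K) with least-below K | P? K
  ... | inj₁ found | _      = inj₁ found
  ... | inj₂ none  | yes pK = inj₁ (K , pK , λ pj → ≮⇒≥ λ j<K → none j<K pj)
  ... | inj₂ none  | no ¬pK = inj₂ λ j<1+K → [ none , (λ { refl → ¬pK }) ]′ (m<1+n⇒m<n∨m≡n j<1+K)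

  least : ∀ {K} → P K → ∃ λ k → P k × ∀ {j} → P j → k ≤ j
  least {K} pK with least-below (suc K)
  ... | inj₁ found = found
  ... | inj₂ none  = contradiction pK (none (n<1+n K))

module Acquisition {N} (G : Graph N) (G? : ∀ u v → Dec (G u v)) (irrefl : ∀ u → ¬ G u u) where

  Legal : Weight N → Fin N → Fin N → Set
  Legal w u v = G u v × w v ≤ w u × 0 < w v

  legal? : ∀ w u v → Dec (Legal w u v)
  legal? w u v = G? u v ×-dec (w v ≤? w u) ×-dec (0 <? w v)

  Move⇒Legal : ∀ {w w′} (m : Move G w w′) → Legal w (Move.u m) (Move.v m)
  Move⇒Legal m = adj , v≤u , v>0 where open Move m

  acquire : Weight N → Fin N → Fin N → Weight N
  acquire w u v x with x ≟ᶠ v | x ≟ᶠ u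
  ... | yes _ | _     = 0
  ... | no _  | yes _ = w u + w v
  ... | no _  | no _  = w x

  acquire-Move : ∀ {w w′} (m : Move G w w′) → acquire w (Move.u m) (Move.v m) ≗ w′
  acquire-Move m x with x ≟ᶠ Move.v m | x ≟ᶠ Move.u m
  ... | yes refl | _        = sym (Move.at-v m)
  ... | no _     | yes refl = sym (Move.at-u m)
  ... | no x≢v   | no x≢u   = sym (Move.elsewhere m x x≢u x≢v)

  acquire-move : ∀ {w u v} → Legal w u v → Move G w (acquire w u v)
  acquire-move {w} {u} {v} (adj , v≤u , v>0) = record
    { u = u ; v = v ; adj = adj ; v≤u = v≤u ; v>0 = v>0
    ; at-u = at-u ; at-v = at-v ; elsewhere = elsewhere }
    where
    at-u : acquire w u v u ≡ w u + w v
    at-u with u ≟ᶠ v | u ≟ᶠ u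
    ... | yes refl | _      = contradiction adj (irrefl u)
    ... | no _     | yes _  = refl
    ... | no _     | no u≢u = contradiction refl u≢u
    at-v : acquire w u v v ≡ 0
    at-v with v ≟ᶠ v
    ... | yes _  = refl
    ... | no v≢v = contradiction refl v≢v
    elsewhere : ∀ x → x ≢ u → x ≢ v → acquire w u v x ≡ w x
    elsewhere x x≢u x≢v with x ≟ᶠ v | x ≟ᶠ u
    ... | yes x≡v | _       = contradiction x≡v x≢v
    ... | no _    | yes x≡u = contradiction x≡u x≢u
    ... | no _    | no _    = refl

  acquire-< : ∀ {w u v} → Legal w u v → residualSize (acquire w u v) < residualSize w
  acquire-< = Move⇒residualSize-< ∘ acquire-move

  terminal? : ∀ w → Dec (Terminal G w)
  terminal? w = all? λ u → all? λ v → G? u v →-dec ((w v ≤? w u) →-dec (w v ≟ 0))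

  no-Legal⇒Terminal : ∀ {w} → ¬ ∃₂ (Legal w) → Terminal G w
  no-Legal⇒Terminal {w} none u v adj v≤u with w v ≟ 0
  ... | yes w≡0 = w≡0
  ... | no w≢0  = contradiction (u , v , adj , v≤u , n≢0⇒n>0 w≢0) none

  Step : Weight N → ℕ → Fin N → Fin N → Set
  Step w k u v = Legal w u v × Reach G (acquire w u v) k

  Reach-unfold : ∀ {w k} → Reach G w k → (Terminal G w × residualSize w ≤ k) ⊎ ∃₂ (Step w k)
  Reach-unfold (_ , (ε , t) , ≤k)      = inj₁ (t , ≤k)
  Reach-unfold (w′ , (m ◅ ms , t) , ≤k) =
    inj₂ (_ , _ , Move⇒Legal m , Reach-cong (acquire-Move m) (w′ , (ms , t) , ≤k))

  Reach-fold : ∀ {w k} → (Terminal G w × residualSize w ≤ k) ⊎ ∃₂ (Step w k) → Reach G w k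
  Reach-fold (inj₁ (t , ≤k))        = _ , (ε , t) , ≤k
  Reach-fold (inj₂ (_ , _ , l , r)) = Reach-◅◅ (acquire-move l ◅ ε) r

  reach? : ∀ w k → Acc _<_ (residualSize w) → Dec (Reach G w k)
  reach? w k (acc rec) = map′ Reach-fold Reach-unfold
    ((terminal? w ×-dec (residualSize w ≤? k)) ⊎-dec any? λ u → any? λ v → step? u v)
    where
    step? : ∀ u v → Dec (Step w k u v)
    step? u v with legal? w u v
    ... | yes l  = map′ (l ,_) proj₂ (reach? (acquire w u v) k (rec (acquire-< l)))
    ... | no ¬l  = no (¬l ∘ proj₁)

  Reach-residualSize : ∀ w → Acc _<_ (residualSize w) → Reach G w (residualSize w)
  Reach-residualSize w (acc rec) with any? (λ u → any? (legal? w u))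
  ... | yes (u , v , l) = Reach-◅◅ (acquire-move l ◅ ε)
    (Reach-mono (<⇒≤ (acquire-< l)) (Reach-residualSize (acquire w u v) (rec (acquire-< l))))
  ... | no none = w , (ε , no-Legal⇒Terminal none) , ≤-refl

  totalAcqNumber : ∀ w → ∃ (IsTotalAcqNumber G w)
  totalAcqNumber w with least (λ k → reach? w k (<-wellFounded _)) (Reach-residualSize w (<-wellFounded _))
  ... | k , (w′ , p , ≤k) , minimal =
    k , (w′ , p , ≤-antisym ≤k (minimal (w′ , p , ≤-refl))) , λ w″ p′ → minimal (w″ , p′ , ≤-refl)

PathG? : ∀ n u v → Dec (PathG n u v)
PathG? n u v = (suc (toℕ u) ≟ toℕ v) ⊎-dec (suc (toℕ v) ≟ toℕ u)

PathG-irrefl : ∀ n u → ¬ PathG n u u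
PathG-irrefl n u = [ 1+n≢n , 1+n≢n ]′

PathG-↑ˡ : ∀ {n} m {u v : Fin n} → PathG n u v → PathG (n + m) (u ↑ˡ m) (v ↑ˡ m)
PathG-↑ˡ m {u} {v} rewrite toℕ-↑ˡ u m | toℕ-↑ˡ v m = id

PathG-↑ʳ : ∀ n {m} {u v : Fin m} → PathG m u v → PathG (n + m) (n ↑ʳ u) (n ↑ʳ v)
PathG-↑ʳ n {u = u} {v} rewrite toℕ-↑ʳ n u | toℕ-↑ʳ n v = Sum.map shift shift
  where
  shift : ∀ {i j} → suc i ≡ j → suc (n + i) ≡ n + j
  shift {i} 1+i≡j = trans (sym (+-suc n i)) (cong (n +_) 1+i≡j)

++-frameˡ : ∀ {n m} {w w′ : Weight n} (g : Weight m) x →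
  (∃ λ i → x ≡ i ↑ˡ m) ⊎ (w′ ++ g) x ≡ (w ++ g) x
++-frameˡ {n} g x with splitAt n x in eq
... | inj₁ i = inj₁ (i , sym (splitAt⁻¹-↑ˡ eq))
... | inj₂ _ = inj₂ refl

++-frameʳ : ∀ {n m} (w : Weight n) {g g′ : Weight m} x →
  (∃ λ j → x ≡ n ↑ʳ j) ⊎ (w ++ g′) x ≡ (w ++ g) x
++-frameʳ {n} w x with splitAt n x in eq
... | inj₁ _ = inj₂ refl
... | inj₂ j = inj₁ (j , sym (splitAt⁻¹-↑ʳ eq))

Star-++ˡ : ∀ {n m} (g : Weight m) {w w′ : Weight n} →
  Star (Move (PathG n)) w w′ → Star (Move (PathG (n + m))) (w ++ g) (w′ ++ g)
Star-++ˡ {m = m} g = gmap (_++ g)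
  (Move-embed (_↑ˡ m) (PathG-↑ˡ m) (lookup-++ˡ _ g) (lookup-++ˡ _ g) (++-frameˡ g))

Star-++ʳ : ∀ {n m} (w : Weight n) {g g′ : Weight m} →
  Star (Move (PathG m)) g g′ → Star (Move (PathG (n + m))) (w ++ g) (w ++ g′)
Star-++ʳ {n} w = gmap (w ++_)
  (Move-embed (n ↑ʳ_) (PathG-↑ʳ n) (lookup-++ʳ w _) (lookup-++ʳ w _) (++-frameʳ w))

++-suc : ∀ {n m} (w : Weight (suc n)) (g : Weight m) → (w ++ g) ∘ suc ≗ (w ∘ suc) ++ g
++-suc {n} w g x with splitAt n x
... | inj₁ _ = refl
... | inj₂ _ = refl

countNonzero-++ : ∀ n {m} (w : Weight n) (g : Weight m) →
  countNonzero (n + m) (w ++ g) ≡ countNonzero n w + countNonzero m g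
countNonzero-++ zero    w g = refl
countNonzero-++ (suc n) {m} w g = begin
  sign (w zero) + countNonzero (n + m) ((w ++ g) ∘ suc)
    ≡⟨ cong (sign (w zero) +_) (countNonzero-cong (n + m) (++-suc w g)) ⟩
  sign (w zero) + countNonzero (n + m) ((w ∘ suc) ++ g)
    ≡⟨ cong (sign (w zero) +_) (countNonzero-++ n (w ∘ suc) g) ⟩
  sign (w zero) + (countNonzero n (w ∘ suc) + countNonzero m g)
    ≡⟨ +-assoc (sign (w zero)) _ _ ⟨
  countNonzero (suc n) w + countNonzero m g ∎
  where open ≡-Reasoning

residualSize-++ : ∀ {n m} (w : Weight n) (g : Weight m) →
  residualSize (w ++ g) ≡ residualSize w + residualSize g
residualSize-++ {n} {m} w g = begin
  residualSize (w ++ g)               ≡⟨ residualSize≡countNonzero (w ++ g) ⟩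
  countNonzero (n + m) (w ++ g)       ≡⟨ countNonzero-++ n w g ⟩
  countNonzero n w + countNonzero m g
    ≡⟨ cong₂ _+_ (residualSize≡countNonzero w) (residualSize≡countNonzero g) ⟨
  residualSize w + residualSize g     ∎
  where open ≡-Reasoning

ones-++ : ∀ n m → ones (n + m) ≗ ones n ++ ones m
ones-++ n m x with splitAt n x
... | inj₁ _ = refl
... | inj₂ _ = refl

lemma2p2 : (n m : ℕ) → 0 < n → 0 < m → (a b : ℕ) → atPath n a → atPath m b →
    ∃ λ c → atPath (n + m) c × c ≤ a + b
lemma2p2 n m _ _ a b ((w₁ , (s₁ , _) , res₁≡a) , _) ((w₂ , (s₂ , _) , res₂≡b) , _) =
  c , at-c , IsTotalAcqNumber⇒≤ at-c reach-a+b
  where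
  open Acquisition (PathG (n + m)) (PathG? (n + m)) (PathG-irrefl (n + m))

  c = proj₁ (totalAcqNumber (ones (n + m)))
  at-c = proj₂ (totalAcqNumber (ones (n + m)))

  juxtaposed : Star (Move (PathG (n + m))) (ones n ++ ones m) (w₁ ++ w₂)
  juxtaposed = Star-++ˡ (ones m) s₁ ◅◅ Star-++ʳ w₁ s₂

  residual≡a+b : residualSize (w₁ ++ w₂) ≡ a + b
  residual≡a+b = trans (residualSize-++ w₁ w₂) (cong₂ _+_ res₁≡a res₂≡b)

  reach-a+b : Reach (PathG (n + m)) (ones (n + m)) (a + b)
  reach-a+b = Reach-cong (ones-++ n m) (Reach-◅◅ juxtaposed
    (subst (Reach _ _) residual≡a+b (Reach-residualSize (w₁ ++ w₂) (<-wellFounded _))))
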